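{- Let $M$ be a matrix, $\sigma$ a substitution and $\Gamma$ a spanning set of connections for $(M,\sigma)$, and assume no two distinct clauses of $M$ become equal under $\sigma$. Suppose $M$ contains two copies $C^i$ and $C^j$ ($i<j$) of the same input clause $C$, and let $\bar{x}_i$ and $\bar{x}_j$ be the sequences of variables of $C^i$ and $C^j$ respectively, listed in the left-to-right order of occurrence of the corresponding variables of $C$. Then there exist a substitution $\sigma'$ and a spanning set of connections $\Gamma'$ for $(M,\sigma')$ such that $\sigma'(\bar{x}_i) \not\succeq \sigma'(\bar{x}_j)$.
   Context: Work in classical first-order logic. A clause is a finite set of literals. A matrix is a finite set of clauses whose variables are pairwise disjoint; each clause is a copy (variable renaming) of an input clause, the $k$-th copy of $C$ being written $C^k$. A global substitution $\sigma$ is applied to the whole matrix. A literal occurrence is a pair $(E,L)$ with $E\in M$, $L\in E$. A connection for $(M,\sigma)$ is an unordered pair $\{(E,L),(F,K)\}$ of literal occurrences with $E\neq F$ such that $\sigma(L)$ and $\sigma(K)$ have the same atom and opposite polarity. A path through $M$ contains exactly one literal occurrence from each clause of $M$; it is open with respect to a set of connections $\Gamma$ if it contains no pair of $\Gamma$; $\Gamma$ is spanning if no path is open. Term order: fix an arbitrary total order $\prec$ on function symbols (constants included). For terms, $f(\bar t)\prec g(\bar s)$ iff either $f\prec g$, or $f=g$ and $\bar t\prec\bar s$, where sequences of terms of equal length are compared lexicographically (the first position where they differ decides, via $\prec$); no other instances of $\prec$ hold (in particular a variable is not $\prec$-related to any term). Write $\bar u\succeq\bar v$ for $\bar v\prec\bar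 u$ or $\bar u=\bar v$. -}

module Defs where

open import Data.Nat using (ℕ; _≟_)
open import Data.Fin using (Fin)
open import Data.Bool using (Bool)
open import Data.Product using (Σ; _×_; _,_; proj₁; proj₂)
open import Data.List using (List; []; _∷_; _++_; map; deduplicate; length)
open import Data.List.Membership.Propositional using (_∈_)
open import Data.List.Relation.Unary.All using (All)
open import Relation.Binary.PropositionalEquality using (_≡_; _≢_)
open import Relation.Nullary using (¬_)
open import Data.Sum using (_⊎_)

data Term (Fun : Set) (V : Set) : Set where
  var : V → Term Fun V
  fun : Fun → List (Term Fun V) → Term Fun V

record Literal (Fun Pred : Set) (V : Set) : Set where
  constructor lit
  field
    pol  : Bool                 -- polarity (true = positive)
    pred : Pred
    args : List (Term Fun V)
open Literal public

atom : ∀ {Fun Pred V} → Literal Fun Pred V → Pred × List (Term Fun V)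
atom L = pred L , args L

module _ {Fun : Set} {V W : Set} (σ : V → Term Fun W) where
  mutual
    applyT : Term Fun V → Term Fun W
    applyT (var x)    = σ x
    applyT (fun f ts) = fun f (applyTs ts)

    applyTs : List (Term Fun V) → List (Term Fun W)
    applyTs []       = []
    applyTs (t ∷ ts) = applyT t ∷ applyTs ts

  applyL : ∀ {Pred} → Literal Fun Pred V → Literal Fun Pred W
  applyL (lit p P ts) = lit p P (applyTs ts)

  applyC : ∀ {Pred} → List (Literal Fun Pred V) → List (Literal Fun Pred W)
  applyC = map applyL

mutual
  varsT : ∀ {Fun} → Term Fun ℕ → List ℕ
  varsT (var x)    = x ∷ []
  varsT (fun f ts) = varsTs ts

  varsTs : ∀ {Fun} → List (Term Fun ℕ) → List ℕ
  varsTs []       = []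
  varsTs (t ∷ ts) = varsT t ++ varsTs ts

varsC : ∀ {Fun Pred} → List (Literal Fun Pred ℕ) → List ℕ
varsC []       = []
varsC (L ∷ Ls) = varsTs (args L) ++ varsC Ls

-- each variable listed once, at its first (leftmost) occurrence
varSeq : ∀ {Fun Pred} → List (Literal Fun Pred ℕ) → List ℕ
varSeq C = deduplicate _≟_ (varsC C)

-- A clause of the matrix is labelled (c , k), meaning the
-- k-th copy C^k of input clause c; its variables are ((c , k) , x) for
-- x a variable of the input clause, so distinct copies have disjoint
-- variables.  A matrix is a duplicate-free list of labels.

Label : ℕ → Set
Label n = Fin n × ℕ

MVar : ℕ → Set
MVar n = Label n × ℕ

module Matrix {Fun Pred : Set} {n : ℕ}
              (S : Fin n → List (Literal Fun Pred ℕ)) where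

  MTerm : Set
  MTerm = Term Fun (MVar n)

  MLit : Set
  MLit = Literal Fun Pred (MVar n)

  Subst : Set
  Subst = MVar n → MTerm

  ren : Label n → ℕ → MTerm
  ren e x = var (e , x)

  clause : Label n → List MLit
  clause e = applyC (ren e) (S (proj₁ e))

  copyVars : Label n → List (MVar n)
  copyVars e = map (λ x → (e , x)) (varSeq (S (proj₁ e)))

  Occ : Set
  Occ = Label n × MLit

  IsOcc : List (Label n) → Occ → Set
  IsOcc M (e , L) = e ∈ M × L ∈ clause e

  Complementary : Subst → MLit → MLit → Set
  Complementary σ L K =
    atom (applyL σ L) ≡ atom (applyL σ K) × pol L ≢ pol K

  -- a connection {(E,L),(F,K)} for (M,σ), represented as an ordered pair
  IsConnection : List (Label n) → Subst → Occ × Occ → Set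
  IsConnection M σ ((e , L) , (f , K)) =
    IsOcc M (e , L) × IsOcc M (f , K) × e ≢ f × Complementary σ L K

  IsPath : List (Label n) → (Label n → MLit) → Set
  IsPath M P = ∀ e → e ∈ M → P e ∈ clause e

  Contains : (Label n → MLit) → Occ → Set
  Contains P (e , L) = P e ≡ L

  Open : List (Occ × Occ) → (Label n → MLit) → Set
  Open Γ P = ∀ o → o ∈ Γ → ¬ (Contains P (proj₁ o) × Contains P (proj₂ o))

  Spanning : List (Label n) → Subst → List (Occ × Occ) → Set
  Spanning M σ Γ =
    All (IsConnection M σ) Γ × (∀ P → IsPath M P → ¬ Open Γ P)

  _≈C_ : List MLit → List MLit → Set
  A ≈C B = (∀ L → L ∈ A → L ∈ B) × (∀ L → L ∈ B → L ∈ A)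

module TermOrder {Fun V : Set} (_<_ : Fun → Fun → Set) where
  mutual
    data _≺_ : Term Fun V → Term Fun V → Set where
      sym<  : ∀ {f g ts ss} → f < g → fun f ts ≺ fun g ss
      args< : ∀ {f ts ss} → ts ≺L ss → fun f ts ≺ fun f ss

    data _≺L_ : List (Term Fun V) → List (Term Fun V) → Set where
      here  : ∀ {t s ts ss} → t ≺ s → length ts ≡ length ss →
              (t ∷ ts) ≺L (s ∷ ss)
      there : ∀ {t ts ss} → ts ≺L ss → (t ∷ ts) ≺L (t ∷ ss)

  _⪰_ : List (Term Fun V) → List (Term Fun V) → Set
  us ⪰ vs = vs ≺L us ⊎ us ≡ vs

-- If σ(x̄ᵢ) ⋡ σ(x̄ⱼ) there is nothing to do.  Otherwise compose σ with the
-- renaming that exchanges the copies Cⁱ and Cʲ: it maps the matrix onto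
-- itself, so it carries Γ to a spanning set for the new substitution, and
-- it exchanges σ(x̄ᵢ) and σ(x̄ⱼ).  The order ⪰ is antisymmetric, and
-- σ(x̄ᵢ) = σ(x̄ⱼ) would make σ(Cⁱ) = σ(Cʲ), so the exchanged pair is no
-- longer in the relation ⪰.
module Submission where

open import Defs
open import Data.Nat using (ℕ; _<_)
open import Data.Fin using (Fin)
open import Data.Product using (Σ; _×_; _,_)
open import Data.List using (List; map)
open import Data.List.Membership.Propositional using (_∈_)
open import Data.List.Relation.Unary.Unique.Propositional using (Unique)
open import Relation.Binary.PropositionalEquality using (_≡_; _≢_)
open import Relation.Binary.Structures using (IsStrictTotalOrder)
open import Relation.Nullary using (¬_)

open import Function using (_∘_)
open import Data.Empty using (⊥-elim)
open import Data.Product using (proj₁; proj₂)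
open import Data.Product.Properties using (≡-dec)
open import Data.Sum using (inj₁; inj₂)
open import Data.List using ([]; _∷_; length)
open import Data.List.Properties using (map-∘; map-cong; ∷-dec; ∷-injective)
open import Data.List.Relation.Unary.Any using (here; there)
import Data.List.Relation.Unary.All as All
import Data.List.Relation.Unary.All.Properties as All
open import Data.List.Membership.Propositional.Properties
  using (∈-map⁺; ∈-++⁺ˡ; ∈-++⁺ʳ; ∈-deduplicate⁺)
import Data.Nat as ℕ
import Data.Nat.Properties as ℕ
import Data.Fin as Fin
open import Relation.Binary.Definitions using (DecidableEquality)
open import Relation.Binary.PropositionalEquality
  using (refl; sym; trans; cong; cong₂; subst; subst₂; module ≡-Reasoning)
open import Relation.Nullary using (Dec; yes; no)
open import Relation.Nullary.Decidable using (map′; _×-dec_; _⊎-dec_)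

module _ {Fun : Set} where

  infixr 9 _∘ₛ_
  _∘ₛ_ : ∀ {U V W : Set} → (V → Term Fun W) → (U → Term Fun V) → U → Term Fun W
  (σ ∘ₛ ρ) x = applyT σ (ρ x)

  mutual
    applyT-∘ : ∀ {U V W : Set} (σ : V → Term Fun W) (ρ : U → Term Fun V) t →
               applyT σ (applyT ρ t) ≡ applyT (σ ∘ₛ ρ) t
    applyT-∘ σ ρ (var x)    = refl
    applyT-∘ σ ρ (fun f ts) = cong (fun f) (applyTs-∘ σ ρ ts)

    applyTs-∘ : ∀ {U V W : Set} (σ : V → Term Fun W) (ρ : U → Term Fun V) ts →
                applyTs σ (applyTs ρ ts) ≡ applyTs (σ ∘ₛ ρ) ts
    applyTs-∘ σ ρ []       = refl
    applyTs-∘ σ ρ (t ∷ ts) = cong₂ _∷_ (applyT-∘ σ ρ t) (applyTs-∘ σ ρ ts)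

  applyL-∘ : ∀ {Pred U V W : Set} (σ : V → Term Fun W) (ρ : U → Term Fun V)
             (L : Literal Fun Pred U) → applyL σ (applyL ρ L) ≡ applyL (σ ∘ₛ ρ) L
  applyL-∘ σ ρ (lit p P ts) = cong (lit p P) (applyTs-∘ σ ρ ts)

  applyC-∘ : ∀ {Pred U V W : Set} (σ : V → Term Fun W) (ρ : U → Term Fun V)
             (C : List (Literal Fun Pred U)) → applyC σ (applyC ρ C) ≡ applyC (σ ∘ₛ ρ) C
  applyC-∘ σ ρ C = trans (sym (map-∘ C)) (map-cong (applyL-∘ σ ρ) C)

  mutual
    applyT-identity : ∀ {V : Set} {σ : V → Term Fun V} → (∀ x → σ x ≡ var x) →
                      ∀ t → applyT σ t ≡ t
    applyT-identity σ≗var (var x)    = σ≗var x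
    applyT-identity σ≗var (fun f ts) = cong (fun f) (applyTs-identity σ≗var ts)

    applyTs-identity : ∀ {V : Set} {σ : V → Term Fun V} → (∀ x → σ x ≡ var x) →
                       ∀ ts → applyTs σ ts ≡ ts
    applyTs-identity σ≗var []       = refl
    applyTs-identity σ≗var (t ∷ ts) =
      cong₂ _∷_ (applyT-identity σ≗var t) (applyTs-identity σ≗var ts)

  applyL-identity : ∀ {Pred V : Set} {σ : V → Term Fun V} → (∀ x → σ x ≡ var x) →
                    (L : Literal Fun Pred V) → applyL σ L ≡ L
  applyL-identity σ≗var (lit p P ts) = cong (lit p P) (applyTs-identity σ≗var ts)

  mutual
    applyT-cong-local : ∀ {W : Set} (σ ρ : ℕ → Term Fun W) t →
                        (∀ x → x ∈ varsT t → σ x ≡ ρ x) → applyT σ t ≡ applyT ρ t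
    applyT-cong-local σ ρ (var x)    agree = agree x (here refl)
    applyT-cong-local σ ρ (fun f ts) agree = cong (fun f) (applyTs-cong-local σ ρ ts agree)

    applyTs-cong-local : ∀ {W : Set} (σ ρ : ℕ → Term Fun W) ts →
                         (∀ x → x ∈ varsTs ts → σ x ≡ ρ x) → applyTs σ ts ≡ applyTs ρ ts
    applyTs-cong-local σ ρ []       agree = refl
    applyTs-cong-local σ ρ (t ∷ ts) agree =
      cong₂ _∷_ (applyT-cong-local σ ρ t (λ x → agree x ∘ ∈-++⁺ˡ))
                (applyTs-cong-local σ ρ ts (λ x → agree x ∘ ∈-++⁺ʳ (varsT t)))

  applyC-cong-local : ∀ {Pred W : Set} (σ ρ : ℕ → Term Fun W) (C : List (Literal Fun Pred ℕ)) →
                      (∀ x → x ∈ varsC C → σ x ≡ ρ x) → applyC σ C ≡ applyC ρ C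
  applyC-cong-local σ ρ []                agree = refl
  applyC-cong-local σ ρ (lit p P ts ∷ C) agree =
    cong₂ _∷_ (cong (lit p P) (applyTs-cong-local σ ρ ts (λ x → agree x ∘ ∈-++⁺ˡ)))
              (applyC-cong-local σ ρ C (λ x → agree x ∘ ∈-++⁺ʳ (varsTs ts)))

map-≡⇒pointwise : ∀ {A B : Set} {f g : A → B} {xs : List A} →
                  map f xs ≡ map g xs → ∀ {x} → x ∈ xs → f x ≡ g x
map-≡⇒pointwise {xs = _ ∷ _} eq (here refl) = proj₁ (∷-injective eq)
map-≡⇒pointwise {xs = _ ∷ _} eq (there x∈) =
  map-≡⇒pointwise (proj₂ (∷-injective eq)) x∈

module TermOrderProperties {Fun V : Set} {_⊏_ : Fun → Fun → Set}
                           (⊏-isStrictTotalOrder : IsStrictTotalOrder _≡_ _⊏_)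
                           (_≟V_ : DecidableEquality V) where
  open TermOrder {Fun} {V} _⊏_
  open IsStrictTotalOrder ⊏-isStrictTotalOrder using (_<?_; irrefl; asym)
    renaming (_≟_ to _≟F_)

  mutual
    _≟T_ : DecidableEquality (Term Fun V)
    var x    ≟T var y    = map′ (cong var) (λ { refl → refl }) (x ≟V y)
    var x    ≟T fun g ss = no (λ ())
    fun f ts ≟T var y    = no (λ ())
    fun f ts ≟T fun g ss =
      map′ (λ { (refl , refl) → refl }) (λ { refl → refl , refl }) (f ≟F g ×-dec ts ≟Ts ss)

    _≟Ts_ : DecidableEquality (List (Term Fun V))
    []       ≟Ts []       = yes refl
    []       ≟Ts (_ ∷ _)  = no (λ ())
    (_ ∷ _)  ≟Ts []       = no (λ ())
    (t ∷ ts) ≟Ts (s ∷ ss) = ∷-dec (t ≟T s) (ts ≟Ts ss)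

  mutual
    _≺?_ : ∀ t s → Dec (t ≺ s)
    var x    ≺? s        = no (λ ())
    fun f ts ≺? var y    = no (λ ())
    fun f ts ≺? fun g ss =
      map′ (λ { (inj₁ f⊏g) → sym< f⊏g ; (inj₂ (refl , ts≺ss)) → args< ts≺ss })
           (λ { (sym< f⊏g) → inj₁ f⊏g ; (args< ts≺ss) → inj₂ (refl , ts≺ss) })
           (f <? g ⊎-dec (f ≟F g ×-dec ts ≺L? ss))

    _≺L?_ : ∀ ts ss → Dec (ts ≺L ss)
    []       ≺L? _        = no (λ ())
    (_ ∷ _)  ≺L? []       = no (λ ())
    (t ∷ ts) ≺L? (s ∷ ss) =
      map′ (λ { (inj₁ (t≺s , len≡)) → here t≺s len≡ ; (inj₂ (refl , ts≺ss)) → there ts≺ss })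
           (λ { (here t≺s len≡) → inj₁ (t≺s , len≡) ; (there ts≺ss) → inj₂ (refl , ts≺ss) })
           ((t ≺? s ×-dec length ts ℕ.≟ length ss) ⊎-dec (t ≟T s ×-dec ts ≺L? ss))

  _⪰?_ : ∀ us vs → Dec (us ⪰ vs)
  us ⪰? vs = vs ≺L? us ⊎-dec us ≟Ts vs

  mutual
    ≺-irrefl : ∀ {t} → ¬ (t ≺ t)
    ≺-irrefl (sym< f⊏f)   = irrefl refl f⊏f
    ≺-irrefl (args< p)    = ≺L-irrefl p

    ≺L-irrefl : ∀ {ts} → ¬ (ts ≺L ts)
    ≺L-irrefl (here t≺t _) = ≺-irrefl t≺t
    ≺L-irrefl (there p)    = ≺L-irrefl p

  mutual
    ≺-asym : ∀ {t s} → t ≺ s → ¬ (s ≺ t)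
    ≺-asym (sym< f⊏g) (sym< g⊏f) = asym f⊏g g⊏f
    ≺-asym (sym< f⊏f) (args< _)  = irrefl refl f⊏f
    ≺-asym (args< _)  (sym< f⊏f) = irrefl refl f⊏f
    ≺-asym (args< p)  (args< q)  = ≺L-asym p q

    ≺L-asym : ∀ {ts ss} → ts ≺L ss → ¬ (ss ≺L ts)
    ≺L-asym (here t≺s _) (here s≺t _) = ≺-asym t≺s s≺t
    ≺L-asym (here t≺t _) (there _)    = ≺-irrefl t≺t
    ≺L-asym (there _)    (here t≺t _) = ≺-irrefl t≺t
    ≺L-asym (there p)    (there q)    = ≺L-asym p q

  ⪰-antisym : ∀ {us vs} → us ⪰ vs → vs ⪰ us → us ≡ vs
  ⪰-antisym (inj₂ us≡vs) _            = us≡vs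
  ⪰-antisym (inj₁ _)     (inj₂ vs≡us) = sym vs≡us
  ⪰-antisym (inj₁ vs≺us) (inj₁ us≺vs) = ⊥-elim (≺L-asym vs≺us us≺vs)

module Transposition {A : Set} (_≟_ : DecidableEquality A) (a b : A) where

  transpose : A → A
  transpose x with x ≟ a | x ≟ b
  ... | yes _ | _     = b
  ... | no _  | yes _ = a
  ... | no _  | no _  = x

  transpose-a : transpose a ≡ b
  transpose-a with a ≟ a
  ... | yes _   = refl
  ... | no a≢a  = ⊥-elim (a≢a refl)

  transpose-b : transpose b ≡ a
  transpose-b with b ≟ a | b ≟ b
  ... | yes b≡a | _      = b≡a
  ... | no _    | yes _  = refl
  ... | no _    | no b≢b = ⊥-elim (b≢b refl)

  transpose-fixes : ∀ {x} → x ≢ a → x ≢ b → transpose x ≡ x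
  transpose-fixes {x} x≢a x≢b with x ≟ a | x ≟ b
  ... | yes x≡a | _       = ⊥-elim (x≢a x≡a)
  ... | no _    | yes x≡b = ⊥-elim (x≢b x≡b)
  ... | no _    | no _    = refl

  transpose-involutive : ∀ x → transpose (transpose x) ≡ x
  transpose-involutive x with x ≟ a | x ≟ b
  ... | yes refl | _        = transpose-b
  ... | no _     | yes refl = transpose-a
  ... | no x≢a   | no x≢b   = transpose-fixes x≢a x≢b

  transpose-preserves : (P : A → Set) → P a → P b → ∀ {x} → P x → P (transpose x)
  transpose-preserves P Pa Pb {x} Px with x ≟ a | x ≟ b
  ... | yes _ | _     = Pb
  ... | no _  | yes _ = Pa
  ... | no _  | no _  = Px

  transpose-invariant : ∀ {B : Set} (h : A → B) → h a ≡ h b → ∀ x → h (transpose x) ≡ h x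
  transpose-invariant h ha≡hb x with x ≟ a | x ≟ b
  ... | yes refl | _        = sym ha≡hb
  ... | no _     | yes refl = ha≡hb
  ... | no _     | no _     = refl

module CopyRenaming {Fun Pred : Set} {n : ℕ} (S : Fin n → List (Literal Fun Pred ℕ))
                    (π : Label n → Label n) (π-involutive : ∀ e → π (π e) ≡ e)
                    (π-sameInput : ∀ e → proj₁ (π e) ≡ proj₁ e) where
  open Matrix S

  π-injective : ∀ {e f} → π e ≡ π f → e ≡ f
  π-injective {e} {f} πe≡πf = trans (sym (π-involutive e)) (trans (cong π πe≡πf) (π-involutive f))

  rename : Subst
  rename (e , x) = var (π e , x)

  rename-involutive : (L : MLit) → applyL rename (applyL rename L) ≡ L
  rename-involutive L = trans (applyL-∘ rename rename L)
    (applyL-identity (λ (e , x) → cong (λ e′ → var (e′ , x)) (π-involutive e)) L)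

  rename-clause : ∀ e → applyC rename (clause e) ≡ clause (π e)
  rename-clause e = trans (applyC-∘ rename (ren e) (S (proj₁ e)))
                          (cong (applyC (ren (π e)) ∘ S) (sym (π-sameInput e)))

  rename-∈-clause : ∀ {e L} → L ∈ clause e → applyL rename L ∈ clause (π e)
  rename-∈-clause {e} L∈E = subst (_ ∈_) (rename-clause e) (∈-map⁺ (applyL rename) L∈E)

  rename-pullback : (σ : Subst) (L : MLit) → applyL (σ ∘ₛ rename) (applyL rename L) ≡ applyL σ L
  rename-pullback σ L = begin
    applyL (σ ∘ₛ rename) (applyL rename L)     ≡⟨ applyL-∘ σ rename _ ⟨
    applyL σ (applyL rename (applyL rename L)) ≡⟨ cong (applyL σ) (rename-involutive L) ⟩
    applyL σ L                                 ∎
    where open ≡-Reasoning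

  copyVars-rename : (σ : Subst) → ∀ e → map (σ ∘ₛ rename) (copyVars e) ≡ map σ (copyVars (π e))
  copyVars-rename σ e = begin
    map (σ ∘ₛ rename) (copyVars e)                      ≡⟨ map-∘ _ ⟨
    map (λ x → σ (π e , x)) (varSeq (S (proj₁ e)))       ≡⟨ cong (λ d → map (λ x → σ (π e , x)) (varSeq (S d)))
                                                                 (π-sameInput e) ⟨
    map (λ x → σ (π e , x)) (varSeq (S (proj₁ (π e)))) ≡⟨ map-∘ _ ⟩
    map σ (copyVars (π e))                              ∎
    where open ≡-Reasoning

  renameOcc : Occ → Occ
  renameOcc (e , L) = π e , applyL rename L

  renameConnection : Occ × Occ → Occ × Occ
  renameConnection (o , o′) = renameOcc o , renameOcc o′

  pullbackPath : (Label n → MLit) → Label n → MLit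
  pullbackPath P e = applyL rename (P (π e))

  pullbackPath-contains : ∀ P o → Contains (pullbackPath P) o → Contains P (renameOcc o)
  pullbackPath-contains P (e , L) eq =
    trans (sym (rename-involutive (P (π e)))) (cong (applyL rename) eq)

  module _ {M : List (Label n)} (π-closed : ∀ {e} → e ∈ M → π e ∈ M) (σ : Subst) where

    isConnection-rename : ∀ γ → IsConnection M σ γ → IsConnection M (σ ∘ₛ rename) (renameConnection γ)
    isConnection-rename ((e , L) , (f , K)) ((e∈M , L∈E) , (f∈M , K∈F) , e≢f , atoms≡ , pol≢) =
      (π-closed e∈M , rename-∈-clause L∈E) , (π-closed f∈M , rename-∈-clause K∈F) ,
      e≢f ∘ π-injective ,
      trans (cong atom (rename-pullback σ L)) (trans atoms≡ (cong atom (sym (rename-pullback σ K)))) ,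
      pol≢

    pullbackPath-isPath : ∀ {P} → IsPath M P → IsPath M (pullbackPath P)
    pullbackPath-isPath {P} isPath e e∈M =
      subst (λ e′ → pullbackPath P e ∈ clause e′) (π-involutive e)
            (rename-∈-clause (isPath (π e) (π-closed e∈M)))

    spanning-rename : ∀ {Γ} → Spanning M σ Γ → Spanning M (σ ∘ₛ rename) (map renameConnection Γ)
    spanning-rename (connections , noOpenPath) =
      All.map⁺ (All.map (isConnection-rename _) connections) ,
      λ P isPath open′ → noOpenPath (pullbackPath P) (pullbackPath-isPath isPath)
        (λ γ γ∈Γ (contains₁ , contains₂) → open′ (renameConnection γ) (∈-map⁺ renameConnection γ∈Γ)
          (pullbackPath-contains P (proj₁ γ) contains₁ , pullbackPath-contains P (proj₂ γ) contains₂))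

≡-decLabel : ∀ {n} → DecidableEquality (Label n)
≡-decLabel = ≡-dec Fin._≟_ ℕ._≟_

≡-decMVar : ∀ {n} → DecidableEquality (MVar n)
≡-decMVar = ≡-dec ≡-decLabel ℕ._≟_

module _ {Fun Pred : Set} {n : ℕ} (S : Fin n → List (Literal Fun Pred ℕ)) where
  open Matrix S

  applyC-clause-copyVars : (σ : Subst) (c : Fin n) (k l : ℕ) →
    map σ (copyVars (c , k)) ≡ map σ (copyVars (c , l)) →
    applyC σ (clause (c , k)) ≡ applyC σ (clause (c , l))
  applyC-clause-copyVars σ c k l σx̄ₖ≡σx̄ₗ = begin
    applyC σ (clause (c , k))               ≡⟨ applyC-∘ σ (ren (c , k)) (S c) ⟩
    applyC (σ ∘ₛ ren (c , k)) (S c)         ≡⟨ applyC-cong-local _ _ (S c) agree ⟩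
    applyC (σ ∘ₛ ren (c , l)) (S c)         ≡⟨ applyC-∘ σ (ren (c , l)) (S c) ⟨
    applyC σ (clause (c , l))               ∎
    where
    open ≡-Reasoning
    agree : ∀ x → x ∈ varsC (S c) → σ ((c , k) , x) ≡ σ ((c , l) , x)
    agree x x∈C = map-≡⇒pointwise
      (trans (map-∘ (varSeq (S c))) (trans σx̄ₖ≡σx̄ₗ (sym (map-∘ (varSeq (S c))))))
      (∈-deduplicate⁺ ℕ._≟_ x∈C)

module _ {Fun Pred : Set} {_⊏_ : Fun → Fun → Set} (⊏-isStrictTotalOrder : IsStrictTotalOrder _≡_ _⊏_)
         {n : ℕ} (S : Fin n → List (Literal Fun Pred ℕ)) (c : Fin n) (i j : ℕ) where
  open Matrix S
  open TermOrder {Fun} {MVar n} _⊏_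
  open TermOrderProperties ⊏-isStrictTotalOrder (≡-decMVar {n})
  open Transposition ≡-decLabel (c , i) (c , j)
  open CopyRenaming S transpose transpose-involutive (transpose-invariant proj₁ refl)

  orientCopies : (M : List (Label n)) → (c , i) ∈ M → (c , j) ∈ M →
    (σ : Subst) (Γ : List (Occ × Occ)) → Spanning M σ Γ →
    applyC σ (clause (c , i)) ≢ applyC σ (clause (c , j)) →
    Σ Subst λ σ′ → Σ (List (Occ × Occ)) λ Γ′ →
      Spanning M σ′ Γ′ × ¬ (map σ′ (copyVars (c , i)) ⪰ map σ′ (copyVars (c , j)))
  orientCopies M ci∈M cj∈M σ Γ spanning σCⁱ≢σCʲ
    with map σ (copyVars (c , i)) ⪰? map σ (copyVars (c , j))
  ... | no ¬σx̄ᵢ⪰σx̄ⱼ = σ , Γ , spanning , ¬σx̄ᵢ⪰σx̄ⱼ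
  ... | yes σx̄ᵢ⪰σx̄ⱼ =
    σ ∘ₛ rename , map renameConnection Γ ,
    spanning-rename (transpose-preserves (_∈ M) ci∈M cj∈M) σ spanning , ¬swapped⪰
    where
    swapped⪰ : map (σ ∘ₛ rename) (copyVars (c , i)) ⪰ map (σ ∘ₛ rename) (copyVars (c , j)) →
               map σ (copyVars (c , j)) ⪰ map σ (copyVars (c , i))
    swapped⪰ = subst₂ _⪰_
      (trans (copyVars-rename σ (c , i)) (cong (map σ ∘ copyVars) transpose-a))
      (trans (copyVars-rename σ (c , j)) (cong (map σ ∘ copyVars) transpose-b))
    ¬swapped⪰ : ¬ (map (σ ∘ₛ rename) (copyVars (c , i)) ⪰ map (σ ∘ₛ rename) (copyVars (c , j)))
    ¬swapped⪰ = σCⁱ≢σCʲ ∘ applyC-clause-copyVars S σ c i j ∘ ⪰-antisym σx̄ᵢ⪰σx̄ⱼ ∘ swapped⪰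

mainTheorem3 : (Fun Pred : Set) (_⊏_ : Fun → Fun → Set) → IsStrictTotalOrder _≡_ _⊏_ →
    (n : ℕ) (S : Fin n → List (Literal Fun Pred ℕ)) →
    let open Matrix S in
    let open TermOrder {Fun} {MVar n} _⊏_ in
    (M : List (Label n)) → Unique M →
    (σ : Subst) (Γ : List (Occ × Occ)) → Spanning M σ Γ →
    (∀ e f → e ∈ M → f ∈ M → e ≢ f →
      ¬ (applyC σ (clause e) ≈C applyC σ (clause f))) →
    (c : Fin n) (i j : ℕ) → (c , i) ∈ M → (c , j) ∈ M → i < j →
    Σ Subst λ σ' → Σ (List (Occ × Occ)) λ Γ' →
      Spanning M σ' Γ' ×
      ¬ (map σ' (copyVars (c , i)) ⪰ map σ' (copyVars (c , j)))
mainTheorem3 Fun Pred _⊏_ ⊏-isStrictTotalOrder n S M _ σ Γ spanning distinct c i j ci∈M cj∈M i<j =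
  orientCopies ⊏-isStrictTotalOrder S c i j M ci∈M cj∈M σ Γ spanning
    (λ σCⁱ≡σCʲ → distinct (c , i) (c , j) ci∈M cj∈M copies-distinct
       ((λ _ → subst (_ ∈_) σCⁱ≡σCʲ) , (λ _ → subst (_ ∈_) (sym σCⁱ≡σCʲ))))
  where
  copies-distinct : (c , i) ≢ (c , j)
  copies-distinct refl = ℕ.<-irrefl refl i<j
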